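{- For all positive integers $n$ and $k$, the outcome class of $G_{n,2nk}$ is $H$.
   Context: Domineering is a two-player game played on a set of squares of a rectangular grid. The players alternate placing dominoes, each covering two adjacent unoccupied squares; the player Vertical must place dominoes covering two vertically adjacent squares and the player Horizontal must place dominoes covering two horizontally adjacent squares. A player with no legal move on her turn loses. $G_{m,n}$ denotes the Domineering position consisting of the full $m\times n$ rectangular board with vertical dimension $m$ (number of rows) and horizontal dimension $n$ (number of columns). The outcome class of a position under optimal play is: $V$ if Vertical wins no matter who moves first; $H$ if Horizontal wins no matter who moves first; $1$ if the player who moves first wins (whichever player that is); $2$ if the player who moves second wins. -}

module Defs where

open import Data.Nat using (ℕ; suc)
open import Data.Fin using (Fin; toℕ; _≟_)
open import Data.Bool using (Bool; true; false; if_then_else_; _∧_)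
open import Data.Product using (_×_)
open import Relation.Nullary.Decidable using (⌊_⌋)
open import Relation.Binary.PropositionalEquality using (_≡_)

-- A Domineering position on an m×n grid: rows Fin m (vertical dimension),
-- columns Fin n (horizontal dimension); a cell is `true` iff it is an
-- unoccupied square belonging to the position.
Board : ℕ → ℕ → Set
Board m n = Fin m → Fin n → Bool

G : (m n : ℕ) → Board m n
G m n = λ _ _ → true

data Player : Set where
  Vertical Horizontal : Player

opp : Player → Player
opp Vertical   = Horizontal
opp Horizontal = Vertical

occupy : ∀ {m n} → Board m n → Fin m → Fin n → Board m n
occupy b r c = λ r₀ c₀ → if ⌊ r₀ ≟ r ⌋ ∧ ⌊ c₀ ≟ c ⌋ then false else b r₀ c₀

data _⊢_⇒_ {m n : ℕ} : Player → Board m n → Board m n → Set where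
  vmove : ∀ {b} (r r' : Fin m) (c : Fin n) → suc (toℕ r) ≡ toℕ r' →
          b r c ≡ true → b r' c ≡ true →
          Vertical ⊢ b ⇒ occupy (occupy b r c) r' c
  hmove : ∀ {b} (r : Fin m) (c c' : Fin n) → suc (toℕ c) ≡ toℕ c' →
          b r c ≡ true → b r c' ≡ true →
          Horizontal ⊢ b ⇒ occupy (occupy b r c) r c'

-- Wins p q b : player p wins (under optimal play) the position b when
-- player q is to move.  (A player with no legal move on her turn loses;
-- the game is finite, so the inductive definition is the right one.)
data Wins {m n : ℕ} (p : Player) : Player → Board m n → Set where
  myMove    : ∀ {b b'} → p ⊢ b ⇒ b' → Wins p (opp p) b' → Wins p p b
  theirMove : ∀ {b} → (∀ b' → opp p ⊢ b ⇒ b' → Wins p p b') → Wins p (opp p) b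

data Outcome : Set where
  V H 𝟏 𝟐 : Outcome

-- "first" = player to move first.
HasOutcome : ∀ {m n} → Board m n → Outcome → Set
HasOutcome b V = Wins Vertical Vertical b × Wins Vertical Horizontal b
HasOutcome b H = Wins Horizontal Horizontal b × Wins Horizontal Vertical b
HasOutcome b 𝟏 = Wins Vertical Vertical b × Wins Horizontal Horizontal b
HasOutcome b 𝟐 = Wins Horizontal Vertical b × Wins Vertical Horizontal b

-- Horizontal plays a symmetry strategy. Cut the board into k blocks of size n × 2n and map
-- each block onto itself by the quarter turn exchanging its two n × n squares. This map σ is
-- a fixpoint-free involution taking every vertical domino to a horizontal one, so as long as
-- the free squares form a σ-symmetric set, Horizontal can answer each Vertical move (x, y)
-- by (σ x, σ y) and restore the symmetry; hence she wins as second player. Moving first, she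
-- plays a domino {x, σ x} straddling the two squares of a block and is then second player
-- on a symmetric position.
module Submission where

open import Defs
open import Data.Nat using (ℕ; suc; _*_; _≥_)

open import Data.Bool using (Bool; true; false; if_then_else_)
open import Data.Empty using (⊥-elim)
open import Data.Fin using (Fin; toℕ; fromℕ; opposite; _↑ˡ_; _↑ʳ_; splitAt; combine; remQuot; _≟_)
import Data.Fin as Fin
open import Data.Fin.Patterns using (0F)
open import Data.Fin.Properties
  using (toℕ<n; toℕ-fromℕ; toℕ-↑ˡ; toℕ-↑ʳ; splitAt-↑ˡ; splitAt-↑ʳ; splitAt⁻¹-↑ˡ; splitAt⁻¹-↑ʳ;
         opposite-prop; opposite-involutive; toℕ-combine; remQuot-combine; combine-remQuot;
         combine-injectiveʳ)
open import Data.Nat using (_+_; _∸_; _≤_; _<_; z≤n; s≤s; s≤s⁻¹)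
open import Data.Nat.Properties
  using (≤-refl; <-≤-trans; +-mono-≤; +-mono-<-≤; +-mono-≤-<; +-suc;
         +-identityʳ; +-∸-assoc; *-comm; m≤m+n; <⇒≢; 1+n≢n; module ≤-Reasoning)
open import Data.Product using (Σ; _×_; _,_; proj₁; proj₂; ∃₂)
open import Data.Product.Properties using (≡-dec)
open import Data.Sum using (_⊎_; inj₁; inj₂; [_,_]′)
import Data.Sum as Sum
open import Function using (_∘_)
open import Relation.Nullary using (¬_; yes; no)
open import Relation.Binary.Definitions using (DecidableEquality)
open import Relation.Binary.PropositionalEquality

Cell : ℕ → ℕ → Set
Cell m n = Fin m × Fin n

_≟ᶜ_ : ∀ {m n} → DecidableEquality (Cell m n)
_≟ᶜ_ = ≡-dec _≟_ _≟_

_at_ : ∀ {m n} → Board m n → Cell m n → Bool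
b at (r , c) = b r c

occupyAt : ∀ {m n} → Board m n → Cell m n → Board m n
occupyAt b (r , c) = occupy b r c

infix 4 _≋_
_≋_ : ∀ {m n} → Board m n → Board m n → Set
b ≋ b′ = ∀ z → b at z ≡ b′ at z

data VerticalDomino {m n} : Cell m n → Cell m n → Set where
  vertical : ∀ {r r′ c} → suc (toℕ r) ≡ toℕ r′ → VerticalDomino (r , c) (r′ , c)

data HorizontalDomino {m n} : Cell m n → Cell m n → Set where
  horizontal : ∀ {r c c′} → suc (toℕ c) ≡ toℕ c′ → HorizontalDomino (r , c) (r , c′)

HorizontalPair : ∀ {m n} → Cell m n → Cell m n → Set
HorizontalPair x y = HorizontalDomino x y ⊎ HorizontalDomino y x

vertical-not-horizontal : ∀ {m n} {x y : Cell m n} → VerticalDomino x y → ¬ HorizontalPair x y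
vertical-not-horizontal (vertical _) (inj₁ (horizontal c+1≡c)) = 1+n≢n c+1≡c
vertical-not-horizontal (vertical _) (inj₂ (horizontal c+1≡c)) = 1+n≢n c+1≡c

horizontal-move : ∀ {m n} {b : Board m n} {x y} → HorizontalDomino x y →
                  b at x ≡ true → b at y ≡ true → Horizontal ⊢ b ⇒ occupyAt (occupyAt b x) y
horizontal-move (horizontal e) = hmove _ _ _ e

module _ {m n : ℕ} where

  occupyAt-self : ∀ (b : Board m n) x → occupyAt b x at x ≡ false
  occupyAt-self b (r , c) with r ≟ r | c ≟ c
  ... | yes _   | yes _   = refl
  ... | no r≢r  | _       = ⊥-elim (r≢r refl)
  ... | yes _   | no c≢c  = ⊥-elim (c≢c refl)

  occupyAt-other : ∀ (b : Board m n) x z → z ≢ x → occupyAt b x at z ≡ b at z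
  occupyAt-other b (r , c) (r₀ , c₀) z≢x with r₀ ≟ r | c₀ ≟ c
  ... | yes refl | yes refl = ⊥-elim (z≢x refl)
  ... | no _     | _        = refl
  ... | yes _    | no _     = refl

  occupyAt-occupied : ∀ (b : Board m n) x z → b at z ≡ false → occupyAt b x at z ≡ false
  occupyAt-occupied b x z bz with z ≟ᶜ x
  ... | yes refl = occupyAt-self b x
  ... | no z≢x   = trans (occupyAt-other b x z z≢x) bz

  occupyAt₂-vacated : ∀ (b : Board m n) x y z → z ≡ x ⊎ z ≡ y →
                      occupyAt (occupyAt b x) y at z ≡ false
  occupyAt₂-vacated b x y .x (inj₁ refl) = occupyAt-occupied (occupyAt b x) y x (occupyAt-self b x)
  occupyAt₂-vacated b x y .y (inj₂ refl) = occupyAt-self (occupyAt b x) y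

  occupyAt₂-untouched : ∀ (b : Board m n) x y z → z ≢ x → z ≢ y →
                        occupyAt (occupyAt b x) y at z ≡ b at z
  occupyAt₂-untouched b x y z z≢x z≢y =
    trans (occupyAt-other (occupyAt b x) y z z≢y) (occupyAt-other b x z z≢x)

  occupyAt-comm : ∀ (b : Board m n) x y → occupyAt (occupyAt b x) y ≋ occupyAt (occupyAt b y) x
  occupyAt-comm b x y z with z ≟ᶜ x | z ≟ᶜ y
  ... | yes z≡x | _       = trans (occupyAt₂-vacated b x y z (inj₁ z≡x)) (sym (occupyAt₂-vacated b y x z (inj₂ z≡x)))
  ... | no _    | yes z≡y = trans (occupyAt₂-vacated b x y z (inj₂ z≡y)) (sym (occupyAt₂-vacated b y x z (inj₁ z≡y)))
  ... | no z≢x  | no z≢y  = trans (occupyAt₂-untouched b x y z z≢x z≢y) (sym (occupyAt₂-untouched b y x z z≢y z≢x))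

  occupyAt-cong : ∀ {b b′ : Board m n} x → b ≋ b′ → occupyAt b x ≋ occupyAt b′ x
  occupyAt-cong {b} {b′} x b≋b′ z with z ≟ᶜ x
  ... | yes refl = trans (occupyAt-self b x) (sym (occupyAt-self b′ x))
  ... | no z≢x   = trans (occupyAt-other b x z z≢x) (trans (b≋b′ z) (sym (occupyAt-other b′ x z z≢x)))

∑ : ∀ {n} → (Fin n → ℕ) → ℕ
∑ {0}     f = 0
∑ {suc n} f = f 0F + ∑ (f ∘ Fin.suc)

∑-mono-≤ : ∀ {n} {f g : Fin n → ℕ} → (∀ i → f i ≤ g i) → ∑ f ≤ ∑ g
∑-mono-≤ {0}     f≤g = z≤n
∑-mono-≤ {suc n} f≤g = +-mono-≤ (f≤g 0F) (∑-mono-≤ (f≤g ∘ Fin.suc))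

∑-mono-< : ∀ {n} {f g : Fin n → ℕ} → (∀ i → f i ≤ g i) → ∀ j → f j < g j → ∑ f < ∑ g
∑-mono-< f≤g 0F          fj<gj = +-mono-<-≤ fj<gj (∑-mono-≤ (f≤g ∘ Fin.suc))
∑-mono-< f≤g (Fin.suc j) fj<gj = +-mono-≤-< (f≤g 0F) (∑-mono-< (f≤g ∘ Fin.suc) j fj<gj)

bit : Bool → ℕ
bit b = if b then 1 else 0

free : ∀ {m n} → Board m n → ℕ
free b = ∑ λ r → ∑ λ c → bit (b r c)

module _ {m n : ℕ} where

  bit-occupyAt-≤ : ∀ (b : Board m n) x z → bit (occupyAt b x at z) ≤ bit (b at z)
  bit-occupyAt-≤ b x z with z ≟ᶜ x
  ... | yes refl rewrite occupyAt-self b x = z≤n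
  ... | no z≢x   rewrite occupyAt-other b x z z≢x = ≤-refl

  free-occupyAt-≤ : ∀ (b : Board m n) x → free (occupyAt b x) ≤ free b
  free-occupyAt-≤ b x = ∑-mono-≤ λ r → ∑-mono-≤ λ c → bit-occupyAt-≤ b x (r , c)

  free-occupyAt-< : ∀ (b : Board m n) x → b at x ≡ true → free (occupyAt b x) < free b
  free-occupyAt-< b x@(r , c) bx≡true =
    ∑-mono-< (λ r₀ → ∑-mono-≤ λ c₀ → bit-occupyAt-≤ b x (r₀ , c₀)) r
      (∑-mono-< (λ c₀ → bit-occupyAt-≤ b x (r , c₀)) c bit<)
    where
    bit< : bit (occupyAt b x at x) < bit (b at x)
    bit< rewrite occupyAt-self b x | bx≡true = s≤s z≤n

record Mirror (m n : ℕ) : Set where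
  field
    σ            : Cell m n → Cell m n
    involutive   : ∀ x → σ (σ x) ≡ x
    fixpointFree : ∀ x → σ x ≢ x
    rotates      : ∀ {x y} → VerticalDomino x y → HorizontalPair (σ x) (σ y)

MirroredDomino : ∀ {m n} → Mirror m n → Set
MirroredDomino {m} {n} M = ∃₂ λ (x y : Cell m n) → HorizontalDomino x y × Mirror.σ M x ≡ y

module MirrorStrategy {m n : ℕ} (M : Mirror m n) where
  open Mirror M

  σ-swap : ∀ {x y} → σ x ≡ y → σ y ≡ x
  σ-swap {x} σx≡y = trans (cong σ (sym σx≡y)) (involutive x)

  σ-avoids-partner : ∀ {x y} → VerticalDomino x y → σ x ≢ y
  σ-avoids-partner d σx≡y =
    vertical-not-horizontal d
      (Sum.swap (subst₂ HorizontalPair σx≡y (σ-swap σx≡y) (rotates d)))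

  Symmetric : Board m n → Set
  Symmetric b = ∀ z → b at σ z ≡ b at z

  symmetric-resp-≋ : ∀ {b b′} → b ≋ b′ → Symmetric b → Symmetric b′
  symmetric-resp-≋ b≋b′ sym-b z = trans (sym (b≋b′ (σ z))) (trans (sym-b z) (b≋b′ z))

  occupy-orbit : ∀ {b x y} → σ x ≡ y → Symmetric b → Symmetric (occupyAt (occupyAt b x) y)
  occupy-orbit {b} {x} {y} σx≡y sym-b z with z ≟ᶜ x | z ≟ᶜ y
  ... | yes refl | _        = trans (occupyAt₂-vacated b x y (σ z) (inj₂ σx≡y))
                                     (sym (occupyAt₂-vacated b x y z (inj₁ refl)))
  ... | no _     | yes refl = trans (occupyAt₂-vacated b x y (σ z) (inj₁ (σ-swap σx≡y)))
                                     (sym (occupyAt₂-vacated b x y z (inj₂ refl)))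
  ... | no z≢x   | no z≢y   =
    trans (occupyAt₂-untouched b x y (σ z) σz≢x σz≢y)
          (trans (sym-b z) (sym (occupyAt₂-untouched b x y z z≢x z≢y)))
    where
    σz≢x : σ z ≢ x
    σz≢x σz≡x = z≢y (trans (sym (σ-swap σz≡x)) σx≡y)
    σz≢y : σ z ≢ y
    σz≢y σz≡y = z≢x (trans (sym (σ-swap σz≡y)) (σ-swap σx≡y))

  occupy-mirrored-reply : ∀ {b x y} → Symmetric b →
    Symmetric (occupyAt (occupyAt (occupyAt (occupyAt b x) y) (σ x)) (σ y))
  occupy-mirrored-reply {b} {x} {y} sym-b =
    symmetric-resp-≋ (occupyAt-cong (σ y) (occupyAt-comm (occupyAt b x) (σ x) y))
      (occupy-orbit refl (occupy-orbit refl sym-b))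

  mirror-square-free : ∀ {b x y z} → Symmetric b → σ z ≢ x → σ z ≢ y → b at z ≡ true →
                       occupyAt (occupyAt b x) y at σ z ≡ true
  mirror-square-free {b} {x} {y} {z} sym-b σz≢x σz≢y bz≡true =
    trans (occupyAt₂-untouched b x y (σ z) σz≢x σz≢y) (trans (sym-b z) bz≡true)

  mirror-strategy : ∀ fuel b → free b < fuel → Symmetric b → Wins Horizontal Vertical b
  mirror-strategy (suc fuel) b free<fuel sym-b =
    theirMove λ { _ (vmove _ _ _ e bx by) → reply (vertical e) bx by }
    where
    reply : ∀ {x y} → VerticalDomino x y → b at x ≡ true → b at y ≡ true →
            Wins Horizontal Horizontal (occupyAt (occupyAt b x) y)
    reply {x} {y} d bx by = [ answer , answer′ ]′ (rotates d)
      where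
      b₁ : Board m n
      b₁ = occupyAt (occupyAt b x) y

      σx-free : b₁ at σ x ≡ true
      σx-free = mirror-square-free sym-b (fixpointFree x) (σ-avoids-partner d) bx

      σy-free : b₁ at σ y ≡ true
      σy-free = mirror-square-free sym-b (σ-avoids-partner d ∘ σ-swap) (fixpointFree y) by

      continue : ∀ p q → Symmetric (occupyAt (occupyAt b₁ p) q) →
                 Wins Horizontal Vertical (occupyAt (occupyAt b₁ p) q)
      continue p q = mirror-strategy fuel _ (begin-strict
        free (occupyAt (occupyAt b₁ p) q) ≤⟨ free-occupyAt-≤ _ q ⟩
        free (occupyAt b₁ p)              ≤⟨ free-occupyAt-≤ b₁ p ⟩
        free b₁                           ≤⟨ free-occupyAt-≤ _ y ⟩
        free (occupyAt b x)               <⟨ free-occupyAt-< b x bx ⟩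
        free b                            ≤⟨ s≤s⁻¹ free<fuel ⟩
        fuel                              ∎)
        where open ≤-Reasoning

      answer : HorizontalDomino (σ x) (σ y) → Wins Horizontal Horizontal b₁
      answer h = myMove (horizontal-move h σx-free σy-free)
                        (continue (σ x) (σ y) (occupy-mirrored-reply sym-b))

      answer′ : HorizontalDomino (σ y) (σ x) → Wins Horizontal Horizontal b₁
      answer′ h = myMove (horizontal-move h σy-free σx-free)
                         (continue (σ y) (σ x)
                           (symmetric-resp-≋ (occupyAt-comm b₁ (σ x) (σ y)) (occupy-mirrored-reply sym-b)))

  symmetric-wins-second : ∀ b → Symmetric b → Wins Horizontal Vertical b
  symmetric-wins-second b = mirror-strategy (suc (free b)) b ≤-refl

  mirror-wins-second : Wins Horizontal Vertical (G m n)
  mirror-wins-second = symmetric-wins-second (G m n) λ _ → refl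

  mirror-wins-first : MirroredDomino M → Wins Horizontal Horizontal (G m n)
  mirror-wins-first (x , y , h , σx≡y) =
    myMove (horizontal-move h refl refl) (symmetric-wins-second _ (occupy-orbit σx≡y λ _ → refl))

↑ˡ≢↑ʳ : ∀ {n} (s t : Fin n) → s ↑ˡ n ≢ n ↑ʳ t
↑ˡ≢↑ʳ {n} s t eq = <⇒≢ toℕ[s]<n+toℕ[t] (cong toℕ eq)
  where
  toℕ[s]<n+toℕ[t] : toℕ (s ↑ˡ n) < toℕ (n ↑ʳ t)
  toℕ[s]<n+toℕ[t] = subst₂ _<_ (sym (toℕ-↑ˡ s n)) (sym (toℕ-↑ʳ n t))
                      (<-≤-trans (toℕ<n s) (m≤m+n n (toℕ t)))

opposite-step : ∀ {n} {i j : Fin n} → suc (toℕ i) ≡ toℕ j → suc (toℕ (opposite j)) ≡ toℕ (opposite i)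
opposite-step {n} {i} {j} e = begin
  suc (toℕ (opposite j))   ≡⟨ cong suc (opposite-prop j) ⟩
  suc (n ∸ suc (toℕ j))    ≡⟨ +-∸-assoc 1 (toℕ<n j) ⟨
  n ∸ toℕ j                ≡⟨ cong (n ∸_) e ⟨
  n ∸ suc (toℕ i)          ≡⟨ opposite-prop i ⟨
  toℕ (opposite i)         ∎
  where open ≡-Reasoning

+-step : ∀ n {i j} → suc i ≡ j → suc (n + i) ≡ n + j
+-step n {i} e = trans (sym (+-suc n i)) (cong (n +_) e)

-- The two n×n halves of an n×2n block are exchanged by a quarter turn,
-- (r, s) ↦ (n-1-s, n+r) and (r, n+t) ↦ (t, n-1-r), which turns vertical dominoes into horizontal ones.
module SquarePair (n : ℕ) where

  swapSquares : Cell n (n + n) → Cell n (n + n)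
  swapSquares (r , c) = [ (λ s → opposite s , n ↑ʳ r) , (λ t → t , opposite r ↑ˡ n) ]′ (splitAt n c)

  swapSquares-left : ∀ r s → swapSquares (r , s ↑ˡ n) ≡ (opposite s , n ↑ʳ r)
  swapSquares-left r s rewrite splitAt-↑ˡ n s n = refl

  swapSquares-right : ∀ r t → swapSquares (r , n ↑ʳ t) ≡ (t , opposite r ↑ˡ n)
  swapSquares-right r t rewrite splitAt-↑ʳ n n t = refl

  data Half : Fin (n + n) → Set where
    left  : ∀ s → Half (s ↑ˡ n)
    right : ∀ t → Half (n ↑ʳ t)

  half : ∀ c → Half c
  half c with splitAt n c in eq
  ... | inj₁ s = subst Half (splitAt⁻¹-↑ˡ eq) (left s)
  ... | inj₂ t = subst Half (splitAt⁻¹-↑ʳ eq) (right t)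

  swapSquares-involutive : ∀ x → swapSquares (swapSquares x) ≡ x
  swapSquares-involutive (r , c) with half c
  ... | left s = begin
    swapSquares (swapSquares (r , s ↑ˡ n)) ≡⟨ cong swapSquares (swapSquares-left r s) ⟩
    swapSquares (opposite s , n ↑ʳ r)      ≡⟨ swapSquares-right (opposite s) r ⟩
    (r , opposite (opposite s) ↑ˡ n)       ≡⟨ cong (λ i → r , i ↑ˡ n) (opposite-involutive s) ⟩
    (r , s ↑ˡ n)                           ∎
    where open ≡-Reasoning
  ... | right t = begin
    swapSquares (swapSquares (r , n ↑ʳ t)) ≡⟨ cong swapSquares (swapSquares-right r t) ⟩
    swapSquares (t , opposite r ↑ˡ n)      ≡⟨ swapSquares-left t (opposite r) ⟩
    (opposite (opposite r) , n ↑ʳ t)       ≡⟨ cong (_, n ↑ʳ t) (opposite-involutive r) ⟩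
    (r , n ↑ʳ t)                           ∎
    where open ≡-Reasoning

  swapSquares-fixpointFree : ∀ x → swapSquares x ≢ x
  swapSquares-fixpointFree (r , c) with half c
  ... | left s  = λ eq → ↑ˡ≢↑ʳ s r (sym (cong proj₂ (trans (sym (swapSquares-left r s)) eq)))
  ... | right t = λ eq → ↑ˡ≢↑ʳ (opposite r) t (cong proj₂ (trans (sym (swapSquares-right r t)) eq))

  swapSquares-rotates : ∀ {x y} → VerticalDomino x y → HorizontalPair (swapSquares x) (swapSquares y)
  swapSquares-rotates (vertical {r} {r′} {c} e) with half c
  ... | left s rewrite swapSquares-left r s | swapSquares-left r′ s =
    inj₁ (horizontal (subst₂ (λ a b → suc a ≡ b) (sym (toℕ-↑ʳ n r)) (sym (toℕ-↑ʳ n r′)) (+-step n e)))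
  ... | right t rewrite swapSquares-right r t | swapSquares-right r′ t =
    inj₂ (horizontal (subst₂ (λ a b → suc a ≡ b) (sym (toℕ-↑ˡ (opposite r′) n)) (sym (toℕ-↑ˡ (opposite r) n))
                       (opposite-step e)))

  squarePair : Mirror n (n + n)
  squarePair = record
    { σ            = swapSquares
    ; involutive   = swapSquares-involutive
    ; fixpointFree = swapSquares-fixpointFree
    ; rotates      = swapSquares-rotates
    }

squarePair-mirroredDomino : ∀ m → MirroredDomino (SquarePair.squarePair (suc m))
squarePair-mirroredDomino m =
  (0F , fromℕ m ↑ˡ n) , (0F , n ↑ʳ 0F) , horizontal adjacent ,
  trans (cong swapSquares (sym (swapSquares-right 0F 0F))) (swapSquares-involutive (0F , n ↑ʳ 0F))
  where
  n = suc m
  open SquarePair n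
  adjacent : suc (toℕ (fromℕ m ↑ˡ n)) ≡ toℕ (n ↑ʳ Fin.zero {m})
  adjacent = trans (cong suc (trans (toℕ-↑ˡ (fromℕ m) n) (toℕ-fromℕ m)))
                   (trans (sym (+-identityʳ n)) (sym (toℕ-↑ʳ n 0F)))

-- Column q·d + s of the wide board is column s of block q (this is Fin.combine).
module Repeat {m d : ℕ} (k : ℕ) (M : Mirror m d) where
  open Mirror M

  lift : Fin k → Cell m d → Cell m (k * d)
  lift q (r , s) = r , combine q s

  data Lifted : Cell m (k * d) → Set where
    lifted : ∀ q x → Lifted (lift q x)

  lifted-view : ∀ z → Lifted z
  lifted-view (r , c) =
    subst Lifted (cong (r ,_) (combine-remQuot {k} d c)) (lifted (proj₁ (remQuot {k} d c)) (r , proj₂ (remQuot {k} d c)))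

  lift-injective : ∀ q {x y} → lift q x ≡ lift q y → x ≡ y
  lift-injective q {_ , s} {_ , s′} eq =
    cong₂ _,_ (cong proj₁ eq) (combine-injectiveʳ q s q s′ (cong proj₂ eq))

  lift-horizontal : ∀ q {x y} → HorizontalDomino x y → HorizontalDomino (lift q x) (lift q y)
  lift-horizontal q (horizontal {c = c} {c′} e) =
    horizontal (subst₂ (λ a b → suc a ≡ b) (sym (toℕ-combine q c)) (sym (toℕ-combine q c′))
                  (+-step (d * toℕ q) e))

  σ-in-block : Fin m → Fin k × Fin d → Cell m (k * d)
  σ-in-block r (q , s) = lift q (σ (r , s))

  σ↑ : Cell m (k * d) → Cell m (k * d)
  σ↑ (r , c) = σ-in-block r (remQuot {k} d c)

  σ↑-lift : ∀ q x → σ↑ (lift q x) ≡ lift q (σ x)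
  σ↑-lift q (r , s) = cong (σ-in-block r) (remQuot-combine q s)

  σ↑-involutive : ∀ z → σ↑ (σ↑ z) ≡ z
  σ↑-involutive z with lifted-view z
  ... | lifted q x = begin
    σ↑ (σ↑ (lift q x))  ≡⟨ cong σ↑ (σ↑-lift q x) ⟩
    σ↑ (lift q (σ x))   ≡⟨ σ↑-lift q (σ x) ⟩
    lift q (σ (σ x))    ≡⟨ cong (lift q) (involutive x) ⟩
    lift q x            ∎
    where open ≡-Reasoning

  σ↑-fixpointFree : ∀ z → σ↑ z ≢ z
  σ↑-fixpointFree z with lifted-view z
  ... | lifted q x = λ eq → fixpointFree x (lift-injective q (trans (sym (σ↑-lift q x)) eq))

  σ↑-rotates : ∀ {z w} → VerticalDomino z w → HorizontalPair (σ↑ z) (σ↑ w)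
  σ↑-rotates {z} d with lifted-view z
  σ↑-rotates (vertical {r′ = r′} e) | lifted q (r , s) =
    subst₂ HorizontalPair (sym (σ↑-lift q (r , s))) (sym (σ↑-lift q (r′ , s)))
      (Sum.map (lift-horizontal q) (lift-horizontal q) (rotates (vertical e)))

  repeated : Mirror m (k * d)
  repeated = record
    { σ            = σ↑
    ; involutive   = σ↑-involutive
    ; fixpointFree = σ↑-fixpointFree
    ; rotates      = σ↑-rotates
    }

  repeated-mirroredDomino : MirroredDomino M → Fin k → MirroredDomino repeated
  repeated-mirroredDomino (x , y , h , σx≡y) q =
    lift q x , lift q y , lift-horizontal q h , trans (σ↑-lift q x) (cong (lift q) σx≡y)

rectangle-mirror : ∀ m k → Σ (Mirror (suc m) (2 * suc m * suc k)) MirroredDomino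
rectangle-mirror m k =
  subst (λ w → Σ (Mirror n w) MirroredDomino) width
    (repeated , repeated-mirroredDomino (squarePair-mirroredDomino m) 0F)
  where
  n = suc m
  open Repeat (suc k) (SquarePair.squarePair n)
  width : suc k * (n + n) ≡ 2 * n * suc k
  width = trans (*-comm (suc k) (n + n)) (cong (λ w → (n + w) * suc k) (sym (+-identityʳ n)))

mainTheorem4 : ∀ (n k : ℕ) → n ≥ 1 → k ≥ 1 → HasOutcome (G n (2 * n * k)) H
mainTheorem4 (suc m) (suc k) _ _ =
  let (M , domino) = rectangle-mirror m k
      open MirrorStrategy M
  in mirror-wins-first domino , mirror-wins-second
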